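{- Let $m\ge1$, $n=2^m-1$, and let $\iota,\kappa\in\dot F^m$. Then every element $\bar c$ of the linear span $\langle R_\iota, R_\kappa\rangle\subset F^n$ of the linear $\iota$-component $R_\iota$ and the linear $\kappa$-component $R_\kappa$ of the Hamming code satisfies $$c_\alpha+c_{\alpha+\iota}+c_{\alpha+\kappa}+c_{\alpha+\iota+\kappa}=0\quad\text{for all }\alpha\in F^m\setminus\langle\iota,\kappa\rangle.$$
   Context: $F^m$ denotes the vector space of binary $m$-tuples over $GF(2)$ (arithmetic mod 2), and $\dot F^m=F^m\setminus\{0^m\}$. Let $n=2^m-1$. Elements of $F^n$ are written $\bar c=\{c_\iota\}_{\iota\in\dot F^m}$, i.e. their coordinates are indexed by the nonzero vectors of $F^m$. $\langle\cdot\rangle$ denotes linear span. The Hamming code is $H=\{\bar c\in F^n : \sum_{\alpha\in\dot F^m} c_\alpha\alpha=0^m\}$. For $\iota\in\dot F^m$, the linear $\iota$-component of $H$ is $R_\iota=\{\bar c\in H : c_\alpha=c_{\alpha+\iota}\text{ for all }\alpha\in F^m\setminus\langle\iota\rangle\}$. -}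

module Defs where

open import Data.Bool using (Bool; true; false; _xor_; _∧_; _∨_; T; T?)
open import Data.Nat using (ℕ; zero; suc)
open import Data.Vec using (Vec; []; _∷_; replicate; zipWith; map)
open import Data.List using (List; []; _∷_; _++_; foldr) renaming (map to lmap)
open import Data.Product using (Σ; ∃; ∃-syntax; _,_; _×_)
open import Data.Sum using (_⊎_)
open import Relation.Nullary using (yes; no; ¬_)
open import Relation.Binary.PropositionalEquality using (_≡_)

Fm : ℕ → Set
Fm m = Vec Bool m

0ᵐ : ∀ {m} → Fm m
0ᵐ = replicate _ false

_⊕_ : ∀ {m} → Fm m → Fm m → Fm m
_⊕_ = zipWith _xor_

_·_ : ∀ {m} → Bool → Fm m → Fm m
a · v = map (a ∧_) v

nz : ∀ {m} → Fm m → Bool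
nz [] = false
nz (x ∷ v) = x ∨ nz v

-- \dot F^m : nonzero vectors (T (nz v) is a proposition)
Ḟ : ℕ → Set
Ḟ m = Σ (Fm m) (λ v → T (nz v))

allVecs : (m : ℕ) → List (Fm m)
allVecs zero = [] ∷ []
allVecs (suc m) = lmap (false ∷_) (allVecs m) ++ lmap (true ∷_) (allVecs m)

-- words of F^n, n = 2^m - 1, coordinates indexed by nonzero vectors of F^m
Word : ℕ → Set
Word m = Ḟ m → Bool

-- c_α for α ∈ F^m (only ever used at nonzero α; value false at 0 is a convention)
coord : ∀ {m} → Word m → Fm m → Bool
coord c v with T? (nz v)
... | yes p = c (v , p)
... | no _ = false

0w : ∀ {m} → Word m
0w _ = false

_+w_ : ∀ {m} → Word m → Word m → Word m
(c +w d) i = c i xor d i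

vsum : ∀ {m} → List (Fm m) → Fm m
vsum = foldr _⊕_ 0ᵐ

Hamming : ∀ {m} → Word m → Set
Hamming {m} c = vsum (lmap (λ α → coord c α · α) (allVecs m)) ≡ 0ᵐ

⟨_⟩₁ : ∀ {m} → Fm m → Fm m → Set
⟨ ι ⟩₁ α = ∃[ a ] α ≡ a · ι

⟨_,_⟩₂ : ∀ {m} → Fm m → Fm m → Fm m → Set
⟨ ι , κ ⟩₂ α = ∃[ a ] ∃[ b ] α ≡ (a · ι) ⊕ (b · κ)

R : ∀ {m} → Ḟ m → Word m → Set
R {m} (ι , _) c = Hamming c × ((α : Fm m) → ¬ ⟨ ι ⟩₁ α → coord c α ≡ coord c (α ⊕ ι))

data Span {m : ℕ} (P : Word m → Set) : Word m → Set where
  span-0   : Span P 0w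
  span-gen : ∀ {c} → P c → Span P c
  span-+   : ∀ {c d} → Span P c → Span P d → Span P (c +w d)

module Submission where

-- For fixed α and directions ι, κ the "square sum"
--   c ↦ c_α + c_{α+ι} + c_{α+κ} + c_{α+ι+κ}
-- is a GF(2)-linear functional on words, so it vanishes on the span of
-- R_ι ∪ R_κ as soon as it vanishes on every element of R_ι and of R_κ.
-- For c ∈ R_ι it vanishes because the square splits into the two
-- ι-pairs {α, α+ι} and {α+κ, α+κ+ι}, on each of which c is constant,
-- since neither α nor α+κ lies on the line ⟨ι⟩ when α ∉ ⟨ι,κ⟩;
-- symmetrically for c ∈ R_κ with the κ-pairs {α, α+κ}, {α+ι, α+ι+κ}.

open import Defs
open import Algebra.Bundles using (CommutativeRing)
open import Data.Bool using (Bool; true; false; _xor_; T?)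
open import Data.Bool.Properties
  using (xor-assoc; xor-comm; xor-same; xor-identityʳ; xor-∧-commutativeRing)
open import Data.Nat using (ℕ; _≤_)
open import Data.Product using (proj₁; proj₂; _,_; _×_)
open import Data.Sum using (_⊎_; inj₁; inj₂)
open import Data.Vec using ([]; _∷_)
open import Data.Vec.Properties using (map-id)
open import Data.Vec.Relation.Binary.Pointwise.Inductive
  using (Pointwise-≡⇒≡; zipWith-comm; zipWith-assoc)
open import Function using (_∘_)
open import Relation.Nullary using (¬_; yes; no)
open import Relation.Binary.PropositionalEquality
open ≡-Reasoning

xor-interchange : ∀ a b c d → (a xor b) xor (c xor d) ≡ (a xor c) xor (b xor d)
xor-interchange = interchange
  where
  open import Algebra.Properties.CommutativeSemigroup
    (CommutativeRing.+-commutativeSemigroup xor-∧-commutativeRing)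
    using (interchange)

⊕-comm : ∀ {m} (u v : Fm m) → u ⊕ v ≡ v ⊕ u
⊕-comm u v = Pointwise-≡⇒≡ (zipWith-comm xor-comm u v)

⊕-assoc : ∀ {m} (u v w : Fm m) → (u ⊕ v) ⊕ w ≡ u ⊕ (v ⊕ w)
⊕-assoc u v w = Pointwise-≡⇒≡ (zipWith-assoc xor-assoc u v w)

⊕-cancelʳ : ∀ {m} (u v : Fm m) → (u ⊕ v) ⊕ v ≡ u
⊕-cancelʳ [] [] = refl
⊕-cancelʳ (a ∷ u) (b ∷ v) = cong₂ _∷_ xor-cancelʳ (⊕-cancelʳ u v)
  where
  xor-cancelʳ : (a xor b) xor b ≡ a
  xor-cancelʳ = trans (xor-assoc a b b) (trans (cong (a xor_) (xor-same b)) (xor-identityʳ a))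

⊕-0· : ∀ {m} (u v : Fm m) → u ⊕ (false · v) ≡ u
⊕-0· [] [] = refl
⊕-0· (a ∷ u) (_ ∷ v) = cong₂ _∷_ (xor-identityʳ a) (⊕-0· u v)

1· : ∀ {m} (v : Fm m) → true · v ≡ v
1· = map-id

⊕-swap : ∀ {m} (α ι κ : Fm m) → (α ⊕ ι) ⊕ κ ≡ (α ⊕ κ) ⊕ ι
⊕-swap α ι κ = begin
  (α ⊕ ι) ⊕ κ  ≡⟨ ⊕-assoc α ι κ ⟩
  α ⊕ (ι ⊕ κ)  ≡⟨ cong (α ⊕_) (⊕-comm ι κ) ⟩
  α ⊕ (κ ⊕ ι)  ≡⟨ ⊕-assoc α κ ι ⟨
  (α ⊕ κ) ⊕ ι  ∎

⟨⟩₂-swap : ∀ {m} {ι κ α : Fm m} → ⟨ ι , κ ⟩₂ α → ⟨ κ , ι ⟩₂ α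
⟨⟩₂-swap {ι = ι} {κ} (a , b , α≡) = b , a , trans α≡ (⊕-comm (a · ι) (b · κ))

-- A point α off the plane ⟨ι,κ⟩ is off the line ⟨ι⟩, and so is its
-- translate α + κ (otherwise α = aι + κ would lie on the plane).
off-plane⇒off-line : ∀ {m} {ι κ α : Fm m} → ¬ ⟨ ι , κ ⟩₂ α
  → ¬ ⟨ ι ⟩₁ α × ¬ ⟨ ι ⟩₁ (α ⊕ κ)
off-plane⇒off-line {ι = ι} {κ} {α} α∉ =
  (λ { (a , α≡) → α∉ (a , false , trans α≡ (sym (⊕-0· (a · ι) κ))) }) ,
  (λ { (a , α+κ≡) → α∉ (a , true , (begin
         α                   ≡⟨ ⊕-cancelʳ α κ ⟨
         (α ⊕ κ) ⊕ κ         ≡⟨ cong₂ _⊕_ α+κ≡ (sym (1· κ)) ⟩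
         (a · ι) ⊕ (true · κ) ∎)) })

record Linear {m : ℕ} (φ : Word m → Bool) : Set where
  field
    map-0 : φ 0w ≡ false
    map-+ : ∀ c d → φ (c +w d) ≡ φ c xor φ d
open Linear

span-annihilated : ∀ {m} {P : Word m → Set} {φ : Word m → Bool} → Linear φ
  → (∀ {c} → P c → φ c ≡ false) → ∀ {c} → Span P c → φ c ≡ false
span-annihilated lin gen span-0 = map-0 lin
span-annihilated lin gen (span-gen p) = gen p
span-annihilated {φ = φ} lin gen (span-+ {c} {d} s t) = begin
  φ (c +w d)       ≡⟨ map-+ lin c d ⟩
  φ c xor φ d      ≡⟨ cong₂ _xor_ (span-annihilated lin gen s) (span-annihilated lin gen t) ⟩
  false            ∎

coord-linear : ∀ {m} (α : Fm m) → Linear (λ c → coord c α)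
coord-linear α with T? (nz α)
... | yes _ = record { map-0 = refl ; map-+ = λ _ _ → refl }
... | no _ = record { map-0 = refl ; map-+ = λ _ _ → refl }

_⊞_ : ∀ {m} → (Word m → Bool) → (Word m → Bool) → Word m → Bool
(φ ⊞ ψ) c = φ c xor ψ c

⊞-linear : ∀ {m} {φ ψ : Word m → Bool} → Linear φ → Linear ψ → Linear (φ ⊞ ψ)
⊞-linear {φ = φ} {ψ} lφ lψ = record
  { map-0 = cong₂ _xor_ (map-0 lφ) (map-0 lψ)
  ; map-+ = λ c d → begin
      φ (c +w d) xor ψ (c +w d)          ≡⟨ cong₂ _xor_ (map-+ lφ c d) (map-+ lψ c d) ⟩
      (φ c xor φ d) xor (ψ c xor ψ d)    ≡⟨ xor-interchange (φ c) (φ d) (ψ c) (ψ d) ⟩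
      (φ c xor ψ c) xor (φ d xor ψ d)    ∎
  }

square : ∀ {m} (α ι κ : Fm m) → Word m → Bool
square α ι κ = ((λ c → coord c α) ⊞ (λ c → coord c (α ⊕ ι)))
             ⊞ ((λ c → coord c (α ⊕ κ)) ⊞ (λ c → coord c ((α ⊕ ι) ⊕ κ)))

square-linear : ∀ {m} (α ι κ : Fm m) → Linear (square α ι κ)
square-linear α ι κ = ⊞-linear (⊞-linear (coord-linear α) (coord-linear (α ⊕ ι)))
                               (⊞-linear (coord-linear (α ⊕ κ)) (coord-linear ((α ⊕ ι) ⊕ κ)))

Invariant : ∀ {m} → Fm m → Word m → Set
Invariant {m} ι c = (β : Fm m) → ¬ ⟨ ι ⟩₁ β → coord c β ≡ coord c (β ⊕ ι)

pair-cancel : ∀ {m} {ι : Fm m} {c : Word m} → Invariant ι c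
  → ∀ β → ¬ ⟨ ι ⟩₁ β → coord c β xor coord c (β ⊕ ι) ≡ false
pair-cancel {ι = ι} {c} inv β β∉ = begin
  coord c β xor coord c (β ⊕ ι)        ≡⟨ cong (_xor coord c (β ⊕ ι)) (inv β β∉) ⟩
  coord c (β ⊕ ι) xor coord c (β ⊕ ι)  ≡⟨ xor-same (coord c (β ⊕ ι)) ⟩
  false                                ∎

-- An ι-invariant word has zero square sum: the square is two ι-pairs.
square-first : ∀ {m} {ι κ α : Fm m} {c : Word m} → Invariant ι c
  → ¬ ⟨ ι , κ ⟩₂ α → square α ι κ c ≡ false
square-first {ι = ι} {κ} {α} {c} inv α∉ = begin
  (coord c α xor coord c (α ⊕ ι)) xor (coord c (α ⊕ κ) xor coord c ((α ⊕ ι) ⊕ κ))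
    ≡⟨ cong (λ γ → (coord c α xor coord c (α ⊕ ι)) xor (coord c (α ⊕ κ) xor coord c γ))
            (⊕-swap α ι κ) ⟩
  (coord c α xor coord c (α ⊕ ι)) xor (coord c (α ⊕ κ) xor coord c ((α ⊕ κ) ⊕ ι))
    ≡⟨ cong₂ _xor_ (pair-cancel inv α α∉ι) (pair-cancel inv (α ⊕ κ) α+κ∉ι) ⟩
  false ∎
  where
  α∉ι = proj₁ (off-plane⇒off-line α∉)
  α+κ∉ι = proj₂ (off-plane⇒off-line α∉)

-- A κ-invariant word has zero square sum: the square is two κ-pairs.
square-second : ∀ {m} {ι κ α : Fm m} {c : Word m} → Invariant κ c
  → ¬ ⟨ ι , κ ⟩₂ α → square α ι κ c ≡ false
square-second {ι = ι} {κ} {α} {c} inv α∉ = begin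
  (coord c α xor coord c (α ⊕ ι)) xor (coord c (α ⊕ κ) xor coord c ((α ⊕ ι) ⊕ κ))
    ≡⟨ xor-interchange (coord c α) _ _ _ ⟩
  (coord c α xor coord c (α ⊕ κ)) xor (coord c (α ⊕ ι) xor coord c ((α ⊕ ι) ⊕ κ))
    ≡⟨ cong₂ _xor_ (pair-cancel inv α α∉κ) (pair-cancel inv (α ⊕ ι) α+ι∉κ) ⟩
  false ∎
  where
  α∉κ = proj₁ (off-plane⇒off-line (α∉ ∘ ⟨⟩₂-swap))
  α+ι∉κ = proj₂ (off-plane⇒off-line (α∉ ∘ ⟨⟩₂-swap))

lemma2 : (m : ℕ) → 1 ≤ m → (ι κ : Ḟ m) → (c : Word m)
    → Span (λ w → R ι w ⊎ R κ w) c
    → (α : Fm m) → ¬ ⟨ proj₁ ι , proj₁ κ ⟩₂ α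
    → (coord c α xor coord c (α ⊕ proj₁ ι)) xor (coord c (α ⊕ proj₁ κ) xor coord c ((α ⊕ proj₁ ι) ⊕ proj₁ κ)) ≡ false
lemma2 m _ ι̇@(ι , _) κ̇@(κ , _) c c∈span α α∉ =
  span-annihilated (square-linear α ι κ) generator c∈span
  where
  generator : ∀ {d} → R ι̇ d ⊎ R κ̇ d → square α ι κ d ≡ false
  generator (inj₁ (_ , inv)) = square-first inv α∉
  generator (inj₂ (_ , inv)) = square-second inv α∉
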